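{- Let $T$ be a tree of order $n \geq 4$ with $\Delta(T) \geq 3$. Then $$\mathrm{hc}(T) = (n-1)(n-1-\zeta(T)) + \zeta'(T) - 2\mathcal{L}_W(T)$$ holds if and only if there exists an ordering $x_0, x_1, \ldots, x_{n-1}$ of the vertices of $T$, with $\mathcal{L}(x_0) = 0$ and $\mathcal{L}(x_{n-1}) = 1$ when $|W(T)| = 1$, and $\mathcal{L}(x_0) = \mathcal{L}(x_{n-1}) = 0$ when $|W(T)| = 2$, such that for all $0 \leq i < j \leq n-1$, $$D(x_i,x_j) \geq \sum_{t=i}^{j-1}\big(\mathcal{L}(x_t) + \mathcal{L}(x_{t+1})\big) - (j-i)(n-1-\zeta(T)) + (n-1).$$ Moreover, under this condition the mapping $h$ defined by $h(x_0) = 0$ and $h(x_{i+1}) = h(x_i) + n - 1 - \zeta(T) - \mathcal{L}(x_i) - \mathcal{L}(x_{i+1})$ for $0 \leq i \leq n-2$ is an optimal hamiltonian coloring of $T$ (i.e. a hamiltonian coloring of span $\mathrm{hc}(T)$).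
   Context: For a connected graph $G$ of order $n$, the detour distance $D(u,v)$ is the length of a longest $u$–$v$ path (in a tree it equals the ordinary distance). A hamiltonian coloring of $G$ is a map $h: V(G) \to \{0,1,2,\ldots\}$ such that $D(u,v) + |h(u)-h(v)| \geq n-1$ for all distinct $u,v$. Its span is $\max\{|h(u)-h(v)|\}$, and $\mathrm{hc}(G)$ is the minimum span over all hamiltonian colorings. For a tree $T$ and $v \in V(T)$ let $w_T(v) = \sum_{u} d(u,v)$; a weight center is a vertex minimizing $w_T$, and $W(T)$ is the set of weight centers (one vertex $w$, or two adjacent vertices $w,w'$). $\zeta(T) = 0$ if $|W(T)| = 1$, $\zeta(T) = 1$ if $|W(T)| = 2$, $\zeta'(T) = 1-\zeta(T)$. $\mathcal{L}(u) = \min\{D(u,x) : x \in W(T)\}$ and $\mathcal{L}_W(T) = \sum_{u \in V(T)} \mathcal{L}(u)$. -}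

module Defs where

open import Data.Nat as ℕ using (ℕ; zero; suc; _+_; _∸_; _≤_; _<_; _⊔_; _⊓_; ∣_-_∣; _<?_; _≤?_)
open import Data.Integer as ℤ using (ℤ; +_)
open import Data.Fin using (Fin; toℕ; fromℕ<)
open import Data.Fin.Properties using (all?)
open import Data.List using (List; []; _∷_; length; map; filter; foldr; allFin)
open import Data.Nat.ListAction using (sum)
open import Data.List.Relation.Unary.Unique.Propositional using (Unique)
open import Data.Product using (Σ; ∃; _×_; _,_)
open import Relation.Binary.PropositionalEquality using (_≡_; _≢_)
open import Relation.Nullary using (¬_; yes; no)
open import Function.Bundles using (_↔_; Inverse)

Rel : ℕ → Set₁
Rel n = Fin n → Fin n → Set

data Walk {n : ℕ} (Adj : Rel n) : Fin n → Fin n → List (Fin n) → Set where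
  [_]  : ∀ u → Walk Adj u u (u ∷ [])
  _∷_  : ∀ {u w v ps} → Adj u w → Walk Adj w v ps → Walk Adj u v (u ∷ ps)

IsPath : ∀ {n} → Rel n → Fin n → Fin n → List (Fin n) → Set
IsPath Adj u v ps = Walk Adj u v ps × Unique ps

pathLength : ∀ {n} → List (Fin n) → ℕ
pathLength ps = length ps ∸ 1

IsSimpleGraph : ∀ {n} → Rel n → Set
IsSimpleGraph Adj = (∀ u v → Adj u v → Adj v u) × (∀ u → ¬ Adj u u)

Connected : ∀ {n} → Rel n → Set
Connected {n} Adj = ∀ (u v : Fin n) → ∃ λ ps → IsPath Adj u v ps

HasCycle : ∀ {n} → Rel n → Set
HasCycle {n} Adj = Σ (Fin n) λ u → Σ (Fin n) λ v → Σ (List (Fin n)) λ ps →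
  IsPath Adj u v ps × 3 ≤ length ps × Adj v u

IsTree : ∀ {n} → Rel n → Set
IsTree Adj = IsSimpleGraph Adj × Connected Adj × ¬ HasCycle Adj

MaxDegreeAtLeast3 : ∀ {n} → Rel n → Set
MaxDegreeAtLeast3 {n} Adj = Σ (Fin n) λ v → Σ (Fin n) λ a → Σ (Fin n) λ b → Σ (Fin n) λ c →
  Adj v a × Adj v b × Adj v c × a ≢ b × a ≢ c × b ≢ c

IsDistance : ∀ {n} → Rel n → (Fin n → Fin n → ℕ) → Set
IsDistance Adj d = ∀ u v →
  (∃ λ ps → IsPath Adj u v ps × pathLength ps ≡ d u v) ×
  (∀ ps → IsPath Adj u v ps → d u v ≤ pathLength ps)

IsDetour : ∀ {n} → Rel n → (Fin n → Fin n → ℕ) → Set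
IsDetour Adj D = ∀ u v →
  (∃ λ ps → IsPath Adj u v ps × pathLength ps ≡ D u v) ×
  (∀ ps → IsPath Adj u v ps → pathLength ps ≤ D u v)

sumV : ∀ {n} → (Fin n → ℕ) → ℕ
sumV {n} f = sum (map f (allFin n))

maxV : ∀ {n} → (Fin n → ℕ) → ℕ
maxV {n} f = foldr _⊔_ 0 (map f (allFin n))

minList : List ℕ → ℕ
minList []       = 0
minList (x ∷ xs) = foldr _⊓_ x xs

weight : ∀ {n} → (Fin n → Fin n → ℕ) → Fin n → ℕ
weight d v = sumV (λ u → d u v)

centers : ∀ {n} → (Fin n → Fin n → ℕ) → List (Fin n)
centers {n} d = filter (λ v → all? (λ u → weight d v ≤? weight d u)) (allFin n)

ζ : ∀ {n} → (Fin n → Fin n → ℕ) → ℕ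
ζ d with length (centers d)
... | 2 = 1
... | _ = 0

ζ′ : ∀ {n} → (Fin n → Fin n → ℕ) → ℕ
ζ′ d = 1 ∸ ζ d

𝓛 : ∀ {n} → (d D : Fin n → Fin n → ℕ) → Fin n → ℕ
𝓛 d D u = minList (map (D u) (centers d))

𝓛W : ∀ {n} → (d D : Fin n → Fin n → ℕ) → ℕ
𝓛W d D = sumV (𝓛 d D)

IsHamColoring : ∀ {n} → (Fin n → Fin n → ℕ) → (Fin n → ℕ) → Set
IsHamColoring {n} D h = ∀ u v → u ≢ v → n ∸ 1 ≤ D u v + ∣ h u - h v ∣

span : ∀ {n} → (Fin n → ℕ) → ℕ
span h = maxV (λ u → maxV (λ v → ∣ h u - h v ∣))

IsHC : ∀ {n} → (Fin n → Fin n → ℕ) → ℤ → Set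
IsHC {n} D k =
  (∃ λ (h : Fin n → ℕ) → IsHamColoring D h × + span h ≡ k) ×
  (∀ (h : Fin n → ℕ) → IsHamColoring D h → k ℤ.≤ + span h)

hcFormula : ∀ {n} → (d D : Fin n → Fin n → ℕ) → ℤ
hcFormula {n} d D =
  + (n ∸ 1) ℤ.* + (n ∸ 1 ∸ ζ d) ℤ.+ + ζ′ d ℤ.- + 2 ℤ.* + 𝓛W d D

-- Orderings x_0, …, x_{n−1} of the vertices (a bijection Fin n ↔ Fin n, x_i = to i)

-- extend a Fin n-indexed sequence to ℕ (value 0 outside the range; never used there)
extℕ : ∀ {n} → (Fin n → ℕ) → ℕ → ℕ
extℕ {n} f k with k <? n
... | yes k<n = f (fromℕ< k<n)
... | no  _   = 0

Lseq : ∀ {n} → (d D : Fin n → Fin n → ℕ) → Fin n ↔ Fin n → ℕ → ℕ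
Lseq d D x = extℕ (λ i → 𝓛 d D (Inverse.to x i))

sumFrom : (ℕ → ℕ) → ℕ → ℕ → ℕ
sumFrom f i zero    = 0
sumFrom f i (suc m) = f i + sumFrom f (suc i) m

sumRange : (ℕ → ℕ) → ℕ → ℕ → ℕ
sumRange f i j = sumFrom f i (j ∸ i)

EndCond : ∀ {n} → (d D : Fin n → Fin n → ℕ) → Fin n ↔ Fin n → Set
EndCond {n} d D x =
  (length (centers d) ≡ 1 → Lseq d D x 0 ≡ 0 × Lseq d D x (n ∸ 1) ≡ 1) ×
  (length (centers d) ≡ 2 → Lseq d D x 0 ≡ 0 × Lseq d D x (n ∸ 1) ≡ 0)

DistCond : ∀ {n} → (d D : Fin n → Fin n → ℕ) → Fin n ↔ Fin n → Set
DistCond {n} d D x = ∀ (i j : Fin n) → toℕ i < toℕ j →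
  + sumRange (λ t → Lseq d D x t + Lseq d D x (suc t)) (toℕ i) (toℕ j)
    ℤ.- + (toℕ j ∸ toℕ i) ℤ.* + (n ∸ 1 ∸ ζ d) ℤ.+ + (n ∸ 1)
  ℤ.≤ + D (Inverse.to x i) (Inverse.to x j)

GoodOrdering : ∀ {n} → (d D : Fin n → Fin n → ℕ) → Fin n ↔ Fin n → Set
GoodOrdering d D x = EndCond d D x × DistCond d D x

hseq : ∀ {n} → (d D : Fin n → Fin n → ℕ) → Fin n ↔ Fin n → ℕ → ℤ
hseq d D x zero = + 0
hseq {n} d D x (suc k) =
  hseq d D x k ℤ.+ + (n ∸ 1 ∸ ζ d) ℤ.- + Lseq d D x k ℤ.- + Lseq d D x (suc k)

hOrd : ∀ {n} → (d D : Fin n → Fin n → ℕ) → Fin n ↔ Fin n → Fin n → ℤ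
hOrd d D x v = hseq d D x (toℕ (Inverse.from x v))

-- In a tree the detour distance D is the path distance, and the distance sum σ(v) = Σᵤ D(v,u)
-- satisfies 2σ(m) + 2 ≤ σ(a) + σ(c) for distinct neighbours a, c of m. So σ strictly increases along
-- a path once it stops decreasing: the weight centres are one vertex or two adjacent ones, whence
-- D(u,v) ≤ 𝓛(u) + 𝓛(v) + ζ, and 𝓛(u) + 𝓛(v) ≥ ζ′ for u ≠ v.
--
-- List the vertices x₀, …, x_{n−1} by increasing colour of a hamiltonian colouring h. By the first
-- inequality consecutive colours rise at least by the increment n−1−ζ−𝓛(xₜ)−𝓛(xₜ₊₁) of the sequence
-- hseq, i.e. h(xₜ) − hseq t is nondecreasing, and since every 𝓛(xₜ) is counted twice except at the
-- ends, hseq (n−1) is the formula plus 𝓛(x₀) + 𝓛(x_{n−1}) − ζ′ ≥ 0. Hence the formula is a lower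
-- bound; when it is attained, h(xⱼ) − h(xᵢ) = hseq j − hseq i, which turns the hamiltonian condition
-- into the distance condition (reflecting h to max h − h if x₀ is not a centre). Conversely the
-- distance condition for i < j is the hamiltonian condition for hseq itself.

module Submission where

open import Defs
open import Data.Nat using (ℕ; zero; suc; _+_; _*_; _∸_; _≤_; _<_; _≤?_; _<?_; z≤n; s≤s; _⊔_; ∣_-_∣)
open import Data.Nat.Properties
open import Data.Nat.ListAction using (sum)
open import Data.Nat.Tactic.RingSolver using (solve-∀)
open import Data.Fin as Fin using (Fin; toℕ; fromℕ<)
open import Data.Fin.Properties
  using (toℕ-fromℕ; opposite-prop; toℕ-injective; toℕ<n; toℕ-fromℕ<; fromℕ<-toℕ; punchOut-injective; <⇒notInjective;
         injective⇒≤; any?; all?)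
  renaming (_≟_ to _≟ᶠ_)
open import Data.List using (List; []; _∷_; _++_; _∷ʳ_; length; map; foldr; tabulate; allFin; drop; reverse; lookup)
open import Data.List.Properties using (map-tabulate; length-++; length-drop; length-reverse; unfold-reverse)
open import Data.List.Membership.Propositional using (_∈_; _∉_)
open import Data.List.Membership.Propositional.Properties using (∈-allFin; ∈-++⁻; ∈-lookup; ∈-filter⁻; ∈-filter⁺)
open import Data.List.Relation.Unary.All as All using (All; []; _∷_)
open import Data.List.Relation.Unary.All.Properties using (¬Any⇒All¬)
open import Data.List.Relation.Unary.Any.Properties using (reverse⁻)
open import Data.List.Relation.Unary.Unique.Propositional using (Unique; []; _∷_)
open import Data.List.Relation.Unary.Unique.Propositional.Properties using (filter⁺; allFin⁺)
open import Data.List.Relation.Unary.Any using (here; there)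
open import Data.Product using (Σ; ∃; _×_; _,_; proj₁; proj₂)
open import Data.Sum using (_⊎_; inj₁; inj₂; [_,_]′)
open import Data.Empty using (⊥-elim)
open import Function using (_∘_; id; case_of_)
open import Function.Bundles using (_↔_; Inverse; mk↔ₛ′)
open import Function.Construct.Composition using (_↔-∘_)
import Data.Fin.Permutation as Permutation
open import Relation.Binary.PropositionalEquality
open import Relation.Nullary using (¬_; Dec; yes; no; contradiction)
open import Relation.Binary using (_Preserves_⟶_; tri<; tri≈; tri>)
import Algebra.Properties.CommutativeMonoid.Sum as CommutativeMonoidSum
open import Data.List.Extrema ≤-totalOrder using (argmin; f[argmin]≤f[xs])

module ∑ = CommutativeMonoidSum +-0-commutativeMonoid
open ∑ using (sum-syntax)

sum-tabulate : ∀ {n} (f : Fin n → ℕ) → sum (tabulate f) ≡ ∑[ i < n ] f i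
sum-tabulate {zero}  f = refl
sum-tabulate {suc n} f = cong (f Fin.zero +_) (sum-tabulate (f ∘ Fin.suc))

sumV≡∑ : ∀ {n} (f : Fin n → ℕ) → sumV f ≡ ∑[ i < n ] f i
sumV≡∑ f = trans (cong sum (map-tabulate id f)) (sum-tabulate f)

∑-const : ∀ n c → ∑[ i < n ] c ≡ n * c
∑-const zero    c = refl
∑-const (suc n) c = cong (c +_) (∑-const n c)

∑-mono : ∀ {n} {f g : Fin n → ℕ} → (∀ i → f i ≤ g i) → ∑[ i < n ] f i ≤ ∑[ i < n ] g i
∑-mono {zero}  _   = z≤n
∑-mono {suc n} f≤g = +-mono-≤ (f≤g Fin.zero) (∑-mono (f≤g ∘ Fin.suc))

∑-mono-excess : ∀ {n} {f g : Fin n → ℕ} (k : Fin n) {c} →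
  (∀ i → f i ≤ g i) → f k + c ≤ g k → ∑[ i < n ] f i + c ≤ ∑[ i < n ] g i
∑-mono-excess {suc n} {f} {g} Fin.zero {c} f≤g fk+c≤gk = begin
  f Fin.zero + ∑.sum (f ∘ Fin.suc) + c ≡⟨ +-comm-middle (f Fin.zero) _ c ⟩
  f Fin.zero + c + ∑.sum (f ∘ Fin.suc) ≤⟨ +-mono-≤ fk+c≤gk (∑-mono (f≤g ∘ Fin.suc)) ⟩
  g Fin.zero + ∑.sum (g ∘ Fin.suc)     ∎
  where
  open ≤-Reasoning
  +-comm-middle : ∀ a b c → a + b + c ≡ a + c + b
  +-comm-middle = solve-∀
∑-mono-excess {suc n} {f} {g} (Fin.suc k) {c} f≤g fk+c≤gk = begin
  f Fin.zero + ∑.sum (f ∘ Fin.suc) + c   ≡⟨ +-assoc (f Fin.zero) _ c ⟩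
  f Fin.zero + (∑.sum (f ∘ Fin.suc) + c) ≤⟨ +-mono-≤ (f≤g Fin.zero) (∑-mono-excess k (f≤g ∘ Fin.suc) fk+c≤gk) ⟩
  g Fin.zero + ∑.sum (g ∘ Fin.suc)       ∎
  where open ≤-Reasoning

maxV-upperBound : ∀ {n} (f : Fin n → ℕ) i → f i ≤ maxV f
maxV-upperBound {n} f i = go (allFin n) (∈-allFin i)
  where
  go : ∀ xs → i ∈ xs → f i ≤ foldr _⊔_ 0 (map f xs)
  go (x ∷ xs) (here refl)  = m≤m⊔n (f x) _
  go (x ∷ xs) (there i∈xs) = ≤-trans (go xs i∈xs) (m≤n⊔m (f x) _)

maxV-least : ∀ {n} (f : Fin n → ℕ) {b} → (∀ i → f i ≤ b) → maxV f ≤ b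
maxV-least {n} f {b} f≤b = go (allFin n)
  where
  go : ∀ xs → foldr _⊔_ 0 (map f xs) ≤ b
  go []       = z≤n
  go (x ∷ xs) = ⊔-lub (f≤b x) (go xs)

∣-∣≤span : ∀ {n} (h : Fin n → ℕ) u v → ∣ h u - h v ∣ ≤ span h
∣-∣≤span h u v =
  ≤-trans (maxV-upperBound (λ v → ∣ h u - h v ∣) v) (maxV-upperBound (λ u → maxV (λ v → ∣ h u - h v ∣)) u)

span-least : ∀ {n} (h : Fin n → ℕ) {b} → (∀ u v → ∣ h u - h v ∣ ≤ b) → span h ≤ b
span-least h ∣-∣≤b = maxV-least _ (λ u → maxV-least _ (∣-∣≤b u))

span-cong : ∀ {n} (h h′ : Fin n → ℕ) → (∀ u v → ∣ h u - h v ∣ ≡ ∣ h′ u - h′ v ∣) → span h ≡ span h′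
span-cong h h′ eq = ≤-antisym
  (span-least h (λ u v → subst (_≤ span h′) (sym (eq u v)) (∣-∣≤span h′ u v)))
  (span-least h′ (λ u v → subst (_≤ span h) (eq u v) (∣-∣≤span h u v)))

span-between : ∀ {n} (h : Fin n → ℕ) a b → h a ≡ 0 → (∀ v → h v ≤ h b) → span h ≡ h b
span-between h a b ha≡0 h≤hb = ≤-antisym
  (span-least h (λ u v → ≤-trans (∣m-n∣≤m⊔n (h u) (h v)) (⊔-lub (h≤hb u) (h≤hb v))))
  (subst (_≤ span h) (trans (cong (λ z → ∣ h b - z ∣) ha≡0) (∣-∣-identityʳ (h b))) (∣-∣≤span h b a))

extℕ-fromℕ< : ∀ {n} (F : Fin n → ℕ) {k} (k<n : k < n) → extℕ F k ≡ F (fromℕ< k<n)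
extℕ-fromℕ< {n} F {k} k<n with k <? n
... | yes _   = refl
... | no  k≮n = contradiction k<n k≮n

extℕ-toℕ : ∀ {n} (F : Fin n → ℕ) i → extℕ F (toℕ i) ≡ F i
extℕ-toℕ F i = trans (extℕ-fromℕ< F (toℕ<n i)) (cong F (fromℕ<-toℕ i _))

extℕ-suc : ∀ {n} (F : Fin (suc n) → ℕ) t → extℕ F (suc t) ≡ extℕ (F ∘ Fin.suc) t
extℕ-suc {n} F t with t <? n
... | yes t<n = extℕ-fromℕ< F (s≤s t<n)
... | no  t≮n with suc t <? suc n
...   | yes t+1<n+1 = contradiction (≤-pred t+1<n+1) t≮n
...   | no  _       = refl

sumFrom-cong : ∀ {f g : ℕ → ℕ} a m → (∀ t → f t ≡ g t) → sumFrom f a m ≡ sumFrom g a m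
sumFrom-cong a zero    f≗g = refl
sumFrom-cong a (suc m) f≗g = cong₂ _+_ (f≗g a) (sumFrom-cong (suc a) m f≗g)

sumFrom-suc : ∀ (f : ℕ → ℕ) a m → sumFrom f (suc a) m ≡ sumFrom (f ∘ suc) a m
sumFrom-suc f a zero    = refl
sumFrom-suc f a (suc m) = cong (f (suc a) +_) (sumFrom-suc f (suc a) m)

sumFrom-+ : ∀ (f : ℕ → ℕ) a m k → sumFrom f a (m + k) ≡ sumFrom f a m + sumFrom f (a + m) k
sumFrom-+ f a zero    k = cong (λ b → sumFrom f b k) (sym (+-identityʳ a))
sumFrom-+ f a (suc m) k = begin
  f a + sumFrom f (suc a) (m + k)                         ≡⟨ cong (f a +_) (sumFrom-+ f (suc a) m k) ⟩
  f a + (sumFrom f (suc a) m + sumFrom f (suc a + m) k)   ≡⟨ sym (+-assoc (f a) _ _) ⟩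
  f a + sumFrom f (suc a) m + sumFrom f (suc a + m) k     ≡⟨ cong (λ b → f a + sumFrom f (suc a) m + sumFrom f b k) (+-suc a m) ⟨
  f a + sumFrom f (suc a) m + sumFrom f (a + suc m) k     ∎
  where open ≡-Reasoning

sumFrom-snoc : ∀ (f : ℕ → ℕ) a m → sumFrom f a (suc m) ≡ sumFrom f a m + f (a + m)
sumFrom-snoc f a m = begin
  sumFrom f a (suc m)              ≡⟨ cong (sumFrom f a) (+-comm 1 m) ⟩
  sumFrom f a (m + 1)              ≡⟨ sumFrom-+ f a m 1 ⟩
  sumFrom f a m + (f (a + m) + 0)  ≡⟨ cong (sumFrom f a m +_) (+-identityʳ _) ⟩
  sumFrom f a m + f (a + m)        ∎
  where open ≡-Reasoning

sumFrom-adjacentPairs : ∀ (f : ℕ → ℕ) a m →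
  sumFrom (λ t → f t + f (suc t)) a m + f a + f (a + m) ≡ 2 * sumFrom f a (suc m)
sumFrom-adjacentPairs f a zero = begin
  0 + f a + f (a + 0) ≡⟨ cong (λ b → f a + f b) (+-identityʳ a) ⟩
  f a + f a           ≡⟨ double (f a) ⟩
  2 * (f a + 0)       ∎
  where
  open ≡-Reasoning
  double : ∀ x → x + x ≡ 2 * (x + 0)
  double = solve-∀
sumFrom-adjacentPairs f a (suc m) = begin
  f a + f (suc a) + S + f a + f (a + suc m)  ≡⟨ cong (λ b → f a + f (suc a) + S + f a + f b) (+-suc a m) ⟩
  f a + f (suc a) + S + f a + f (suc a + m)  ≡⟨ regroup (f a) (f (suc a)) S (f (suc a + m)) ⟩
  2 * f a + (S + f (suc a) + f (suc a + m))  ≡⟨ cong (2 * f a +_) (sumFrom-adjacentPairs f (suc a) m) ⟩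
  2 * f a + 2 * sumFrom f (suc a) (suc m)    ≡⟨ sym (*-distribˡ-+ 2 (f a) _) ⟩
  2 * sumFrom f a (suc (suc m))              ∎
  where
  open ≡-Reasoning
  S : ℕ
  S = sumFrom (λ t → f t + f (suc t)) (suc a) m
  regroup : ∀ x y s z → x + y + s + x + z ≡ 2 * x + (s + y + z)
  regroup = solve-∀

sumFrom-extℕ : ∀ {n} (F : Fin n → ℕ) → sumFrom (extℕ F) 0 n ≡ ∑[ i < n ] F i
sumFrom-extℕ {zero}  F = refl
sumFrom-extℕ {suc n} F = cong₂ _+_ (extℕ-fromℕ< F (s≤s z≤n)) (begin
  sumFrom (extℕ F) 1 n            ≡⟨ sumFrom-suc (extℕ F) 0 n ⟩
  sumFrom (extℕ F ∘ suc) 0 n      ≡⟨ sumFrom-cong 0 n (extℕ-suc F) ⟩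
  sumFrom (extℕ (F ∘ Fin.suc)) 0 n ≡⟨ sumFrom-extℕ (F ∘ Fin.suc) ⟩
  ∑.sum (F ∘ Fin.suc)             ∎)
  where open ≡-Reasoning

-- Sorting the vertices by their colours

injective⇒surjective : ∀ {n} (f : Fin n → Fin n) → (∀ {u v} → f u ≡ f v → u ≡ v) → ∀ j → ∃ λ v → f v ≡ j
injective⇒surjective {suc m} f f-inj j with any? (λ v → f v ≟ᶠ j)
... | yes hit = hit
... | no miss = ⊥-elim (<⇒notInjective ≤-refl squeezed-injective)
  where
  j≢f : ∀ v → j ≢ f v
  j≢f v j≡fv = miss (v , sym j≡fv)
  squeezed : Fin (suc m) → Fin m
  squeezed v = Fin.punchOut (j≢f v)
  squeezed-injective : ∀ {u v} → squeezed u ≡ squeezed v → u ≡ v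
  squeezed-injective eq = f-inj (punchOut-injective (j≢f _) (j≢f _) eq)

SortedBy : ∀ {n} → (Fin n → ℕ) → Fin n ↔ Fin n → Set
SortedBy h x = (h ∘ Inverse.to x) Preserves Fin._≤_ ⟶ _≤_

module Sorting {n : ℕ} (h : Fin n → ℕ) where

  key : Fin n → ℕ
  key v = h v * n + toℕ v

  key-mono-< : ∀ {u v} → h u < h v → key u < key v
  key-mono-< {u} {v} hu<hv = begin-strict
    h u * n + toℕ u <⟨ +-monoʳ-< (h u * n) (toℕ<n u) ⟩
    h u * n + n     ≡⟨ +-comm (h u * n) n ⟩
    suc (h u) * n   ≤⟨ *-monoˡ-≤ n hu<hv ⟩
    h v * n         ≤⟨ m≤m+n (h v * n) (toℕ v) ⟩
    key v           ∎
    where open ≤-Reasoning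

  key-injective : ∀ {u v} → key u ≡ key v → u ≡ v
  key-injective {u} {v} eq with <-cmp (h u) (h v)
  ... | tri< hu<hv _ _ = contradiction eq (<⇒≢ (key-mono-< hu<hv))
  ... | tri> _ _ hv<hu = contradiction (sym eq) (<⇒≢ (key-mono-< hv<hu))
  ... | tri≈ _ hu≡hv _ =
    toℕ-injective (+-cancelˡ-≡ (h u * n) _ _ (trans eq (cong (λ z → z * n + toℕ v) (sym hu≡hv))))

  h-mono-key : ∀ {u v} → key u ≤ key v → h u ≤ h v
  h-mono-key {u} {v} ku≤kv with h u ≤? h v
  ... | yes hu≤hv = hu≤hv
  ... | no  hu≰hv = contradiction ku≤kv (<⇒≱ (key-mono-< (≰⇒> hu≰hv)))

  below : Fin n → Fin n → ℕ
  below u v with key u <? key v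
  ... | yes _ = 1
  ... | no  _ = 0

  below-irrefl : ∀ v → below v v ≡ 0
  below-irrefl v with key v <? key v
  ... | yes kv<kv = contradiction kv<kv (<-irrefl refl)
  ... | no  _     = refl

  below≤1 : ∀ u v → below u v ≤ 1
  below≤1 u v with key u <? key v
  ... | yes _ = ≤-refl
  ... | no  _ = z≤n

  rank : Fin n → ℕ
  rank v = ∑[ u < n ] below u v

  rank<n : ∀ v → rank v < n
  rank<n v = begin-strict
    rank v               <⟨ m<m+n (rank v) ≤-refl ⟩
    rank v + 1           ≤⟨ ∑-mono-excess v (λ u → below≤1 u v) (≤-reflexive (cong (_+ 1) (below-irrefl v))) ⟩
    ∑[ u < n ] 1         ≡⟨ trans (∑-const n 1) (*-identityʳ n) ⟩
    n                    ∎
    where open ≤-Reasoning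

  rank-mono-< : ∀ {u v} → key u < key v → rank u < rank v
  rank-mono-< {u} {v} ku<kv = ≤-trans (≤-reflexive (+-comm 1 (rank u))) (∑-mono-excess u below-mono at-u)
    where
    below-mono : ∀ y → below y u ≤ below y v
    below-mono y with key y <? key u | key y <? key v
    ... | yes _     | yes _     = ≤-refl
    ... | yes ky<ku | no  ky≮kv = contradiction (<-trans ky<ku ku<kv) ky≮kv
    ... | no  _     | _         = z≤n
    at-u : below u u + 1 ≤ below u v
    at-u rewrite below-irrefl u with key u <? key v
    ... | yes _     = ≤-refl
    ... | no  ku≮kv = contradiction ku<kv ku≮kv

  position : Fin n → Fin n
  position v = fromℕ< (rank<n v)

  toℕ-position : ∀ v → toℕ (position v) ≡ rank v
  toℕ-position v = toℕ-fromℕ< (rank<n v)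

  key-reflects-rank : ∀ {u v} → rank u ≡ rank v → key u ≡ key v
  key-reflects-rank {u} {v} ru≡rv with <-cmp (key u) (key v)
  ... | tri< ku<kv _ _ = contradiction ru≡rv (<⇒≢ (rank-mono-< ku<kv))
  ... | tri≈ _ ku≡kv _ = ku≡kv
  ... | tri> _ _ kv<ku = contradiction (sym ru≡rv) (<⇒≢ (rank-mono-< kv<ku))

  position-injective : ∀ {u v} → position u ≡ position v → u ≡ v
  position-injective {u} {v} eq =
    key-injective (key-reflects-rank (trans (sym (toℕ-position u)) (trans (cong toℕ eq) (toℕ-position v))))

  vertexAt : Fin n → Fin n
  vertexAt i = proj₁ (injective⇒surjective position position-injective i)

  position-vertexAt : ∀ i → position (vertexAt i) ≡ i
  position-vertexAt i = proj₂ (injective⇒surjective position position-injective i)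

  ordering : Fin n ↔ Fin n
  ordering = mk↔ₛ′ vertexAt position (λ v → position-injective (position-vertexAt (position v))) position-vertexAt

  ordering-sorted : SortedBy h ordering
  ordering-sorted {i} {j} i≤j with key (vertexAt j) <? key (vertexAt i)
  ... | no  kj≮ki = h-mono-key (≮⇒≥ kj≮ki)
  ... | yes kj<ki = contradiction (rank-mono-< kj<ki) (≤⇒≯ (subst₂ _≤_ (sym (rank-vertexAt i)) (sym (rank-vertexAt j)) i≤j))
    where rank-vertexAt : ∀ k → rank (vertexAt k) ≡ toℕ k
          rank-vertexAt k = trans (sym (toℕ-position (vertexAt k))) (cong toℕ (position-vertexAt k))

sortingPermutation : ∀ {n} (h : Fin n → ℕ) → ∃ λ x → SortedBy h x
sortingPermutation h = Sorting.ordering h , Sorting.ordering-sorted h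

+∣-∣⇒+ : ∀ {k D a b} → a ≤ b → k ≤ D + ∣ a - b ∣ → k + a ≤ D + b
+∣-∣⇒+ {k} {D} {a} {b} a≤b k≤ = begin
  k + a               ≤⟨ +-monoˡ-≤ a k≤ ⟩
  D + ∣ a - b ∣ + a   ≡⟨ cong (λ z → D + z + a) (m≤n⇒∣m-n∣≡n∸m a≤b) ⟩
  D + (b ∸ a) + a     ≡⟨ +-assoc D (b ∸ a) a ⟩
  D + (b ∸ a + a)     ≡⟨ cong (D +_) (m∸n+n≡m a≤b) ⟩
  D + b               ∎
  where open ≤-Reasoning

+⇒+∣-∣ : ∀ {k D a b} → D ≤ k → k + a ≤ D + b → a ≤ b × k ≤ D + ∣ a - b ∣
+⇒+∣-∣ {k} {D} {a} {b} D≤k k+a≤D+b = a≤b , +-cancelʳ-≤ a k _ (begin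
  k + a               ≤⟨ k+a≤D+b ⟩
  D + b               ≡⟨ cong (D +_) (m∸n+n≡m a≤b) ⟨
  D + (b ∸ a + a)     ≡⟨ +-assoc D (b ∸ a) a ⟨
  D + (b ∸ a) + a     ≡⟨ cong (λ z → D + z + a) (m≤n⇒∣m-n∣≡n∸m a≤b) ⟨
  D + ∣ a - b ∣ + a   ∎)
  where
  open ≤-Reasoning
  a≤b : a ≤ b
  a≤b = +-cancelˡ-≤ k a b (≤-trans k+a≤D+b (+-monoˡ-≤ b D≤k))

∣∸-∸∣ : ∀ M {a b} → a ≤ M → b ≤ M → ∣ (M ∸ a) - (M ∸ b) ∣ ≡ ∣ a - b ∣
∣∸-∸∣ M       {zero}  {zero}  _         _         = trans (m≤n⇒∣m-n∣≡n∸m (≤-refl {M})) (n∸n≡0 M)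
∣∸-∸∣ M       {zero}  {suc b} _         b≤M       = trans (m≤n⇒∣n-m∣≡n∸m (m∸n≤m M (suc b))) (m∸[m∸n]≡n b≤M)
∣∸-∸∣ M       {suc a} {zero}  a≤M       _         = trans (m≤n⇒∣m-n∣≡n∸m (m∸n≤m M (suc a))) (m∸[m∸n]≡n a≤M)
∣∸-∸∣ (suc M) {suc a} {suc b} (s≤s a≤M) (s≤s b≤M) = ∣∸-∸∣ M a≤M b≤M

-- Trees: paths, detour distance and weight centres

ζ≤1 : ∀ {n} (d : Fin n → Fin n → ℕ) → ζ d ≤ 1
ζ≤1 d with length (centers d)
... | 0                 = z≤n
... | 1                 = z≤n
... | 2                 = ≤-refl
... | suc (suc (suc _)) = z≤n

ζ-one : ∀ {n} (d : Fin n → Fin n → ℕ) → length (centers d) ≡ 1 → ζ d ≡ 0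
ζ-one d eq with length (centers d)
ζ-one d refl | .1 = refl

ζ-two : ∀ {n} (d : Fin n → Fin n → ℕ) → length (centers d) ≡ 2 → ζ d ≡ 1
ζ-two d eq with length (centers d)
ζ-two d refl | .2 = refl

minList-map-attained : ∀ {A : Set} (f : A → ℕ) x xs → ∃ λ y → y ∈ x ∷ xs × minList (map f (x ∷ xs)) ≡ f y
minList-map-attained f x []       = x , here refl , refl
minList-map-attained f x (y ∷ ys) with minList-map-attained f x ys | ⊓-sel (f y) (minList (map f (x ∷ ys)))
... | _ , _ , _            | inj₁ min≡fy = y , there (here refl) , min≡fy
... | z , z∈x∷ys , min≡fz | inj₂ min≡min = z , widen z∈x∷ys , trans min≡min min≡fz
  where widen : ∀ {z} → z ∈ x ∷ ys → z ∈ x ∷ y ∷ ys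
        widen (here z≡x)  = here z≡x
        widen (there z∈ys) = there (there z∈ys)

unique⇒length≤ : ∀ {n} (xs : List (Fin n)) → Unique xs → length xs ≤ n
unique⇒length≤ xs xs-unique = injective⇒≤ (lookup-injective xs xs-unique)
  where
  lookup-injective : ∀ {n} (xs : List (Fin n)) → Unique xs → ∀ {i j} → lookup xs i ≡ lookup xs j → i ≡ j
  lookup-injective (x ∷ xs) _            {Fin.zero}  {Fin.zero}  _  = refl
  lookup-injective (x ∷ xs) (x∉xs ∷ _)   {Fin.zero}  {Fin.suc j} eq = ⊥-elim (All.lookup x∉xs (∈-lookup j) eq)
  lookup-injective (x ∷ xs) (x∉xs ∷ _)   {Fin.suc i} {Fin.zero}  eq = ⊥-elim (All.lookup x∉xs (∈-lookup i) (sym eq))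
  lookup-injective (x ∷ xs) (_ ∷ unique) {Fin.suc i} {Fin.suc j} eq = cong Fin.suc (lookup-injective xs unique eq)

module Tree {n : ℕ} (Adj : Rel n) (tree : IsTree Adj) where

  open import Data.List.Membership.DecPropositional (_≟ᶠ_ {n}) using (_∈?_)

  adj-sym : ∀ {u v} → Adj u v → Adj v u
  adj-sym {u} {v} = proj₁ (proj₁ tree) u v

  adj⇒≢ : ∀ {u v} → Adj u v → u ≢ v
  adj⇒≢ {u} e refl = proj₂ (proj₁ tree) u e

  connected : Connected Adj
  connected = proj₁ (proj₂ tree)

  acyclic : ¬ HasCycle Adj
  acyclic = proj₂ (proj₂ tree)

  walk-∋-end : ∀ {u v ps} → Walk Adj u v ps → v ∈ ps
  walk-∋-end [ u ]   = here refl
  walk-∋-end (_ ∷ w) = there (walk-∋-end w)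

  walk-length≡ : ∀ {u v ps} → Walk Adj u v ps → length ps ≡ suc (pathLength ps)
  walk-length≡ [ u ]   = refl
  walk-length≡ (_ ∷ _) = refl

  walk-starts : ∀ {u v ps} → Walk Adj u v ps → ∃ λ qs → ps ≡ u ∷ qs
  walk-starts [ u ]   = _ , refl
  walk-starts (_ ∷ _) = _ , refl

  _++ʷ_ : ∀ {u v w ps qs} → Walk Adj u v ps → Walk Adj v w qs → Walk Adj u w (ps ++ drop 1 qs)
  [ u ]   ++ʷ [ .u ]  = [ u ]
  [ u ]   ++ʷ (e ∷ q) = e ∷ q
  (e ∷ p) ++ʷ q       = e ∷ (p ++ʷ q)

  _∷ʳʷ_ : ∀ {u v w ps} → Walk Adj u v ps → Adj v w → Walk Adj u w (ps ∷ʳ w)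
  [ u ]    ∷ʳʷ e = e ∷ [ _ ]
  (e′ ∷ p) ∷ʳʷ e = e′ ∷ (p ∷ʳʷ e)

  reverseʷ : ∀ {u v ps} → Walk Adj u v ps → Walk Adj v u (reverse ps)
  reverseʷ [ u ]                = [ u ]
  reverseʷ (_∷_ {ps = ps} e p) = subst (Walk Adj _ _) (sym (unfold-reverse _ ps)) (reverseʷ p ∷ʳʷ adj-sym e)

  suffixʷ : ∀ {u v ps x} → Walk Adj u v ps → x ∈ ps →
    ∃ λ rs → Walk Adj x v rs × (∀ {y} → y ∈ rs → y ∈ ps) × length rs ≤ length ps × (Unique ps → Unique rs)
  suffixʷ [ u ]   (here refl) = _ , [ u ] , id , ≤-refl , id
  suffixʷ (e ∷ p) (here refl) = _ , e ∷ p , id , ≤-refl , id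
  suffixʷ (e ∷ p) (there x∈ps) with suffixʷ p x∈ps
  ... | rs , r , rs⊆ps , |rs|≤ , unique = rs , r , there ∘ rs⊆ps , m≤n⇒m≤1+n |rs|≤ , λ { (_ ∷ u) → unique u }

  walk⇒path : ∀ {u v ps} → Walk Adj u v ps →
    ∃ λ qs → IsPath Adj u v qs × (∀ {y} → y ∈ qs → y ∈ ps) × length qs ≤ length ps
  walk⇒path [ u ] = _ , ([ u ] , [] ∷ []) , id , ≤-refl
  walk⇒path {u} (e ∷ p) with walk⇒path p
  ... | qs , (q , q-unique) , qs⊆ps , |qs|≤ with u ∈? qs
  ...   | yes u∈qs =
    let rs , r , rs⊆qs , |rs|≤ , r-unique = suffixʷ q u∈qs
    in rs , (r , r-unique q-unique) , there ∘ qs⊆ps ∘ rs⊆qs , ≤-trans |rs|≤ (m≤n⇒m≤1+n |qs|≤)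
  ...   | no  u∉qs =
    u ∷ qs , (e ∷ q , ¬Any⇒All¬ qs u∉qs ∷ q-unique) ,
    (λ { (here y≡u) → here y≡u ; (there y∈qs) → there (qs⊆ps y∈qs) }) , s≤s |qs|≤

  -- If the two paths leave u through different neighbours, out along one and back along the other closes a cycle.
  path-unique : ∀ {u v ps qs} → IsPath Adj u v ps → IsPath Adj u v qs → ps ≡ qs
  path-unique ([ u ] , _)     ([ .u ] , _)     = refl
  path-unique ([ u ] , _)     (e ∷ q , u∉q ∷ _) = ⊥-elim (All.lookup u∉q (walk-∋-end q) refl)
  path-unique (e ∷ p , u∉p ∷ _) ([ u ] , _)     = ⊥-elim (All.lookup u∉p (walk-∋-end p) refl)
  path-unique {u} (_∷_ {w = p₁} e p , u∉p ∷ p-unique) (_∷_ {w = q₁} f q , u∉q ∷ q-unique) with p₁ ≟ᶠ q₁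
  ... | yes refl = cong (u ∷_) (path-unique (p , p-unique) (q , q-unique))
  ... | no  p₁≢q₁ with walk⇒path (p ++ʷ reverseʷ q)
  ...   | rs , (r , r-unique) , rs⊆ , _ =
    ⊥-elim (acyclic (u , q₁ , u ∷ rs , (e ∷ r , ¬Any⇒All¬ rs u∉rs ∷ r-unique) , s≤s (long r) , adj-sym f))
    where
    u∉rs : u ∉ rs
    u∉rs u∈rs with ∈-++⁻ _ (rs⊆ u∈rs)
    ... | inj₁ u∈p  = All.lookup u∉p u∈p refl
    ... | inj₂ u∈q′ = All.lookup u∉q (reverse⁻ (drop1⊆ _ u∈q′)) refl
      where drop1⊆ : ∀ xs {y} → y ∈ drop 1 xs → y ∈ xs
            drop1⊆ (_ ∷ _) = there
    long : ∀ {rs} → Walk Adj p₁ q₁ rs → 2 ≤ length rs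
    long [ _ ]   = ⊥-elim (p₁≢q₁ refl)
    long (_ ∷ w) = s≤s (≤-trans (s≤s z≤n) (≤-reflexive (sym (walk-length≡ w))))

  module Detour (D : Fin n → Fin n → ℕ) (isDetour : IsDetour Adj D) where

    D-path : ∀ {u v ps} → IsPath Adj u v ps → D u v ≡ pathLength ps
    D-path {u} {v} P with proj₁ (isDetour u v)
    ... | _ , Q , |Q|≡D = trans (sym |Q|≡D) (cong pathLength (path-unique Q P))

    D-walk : ∀ {u v ps} → Walk Adj u v ps → D u v ≤ pathLength ps
    D-walk w with walk⇒path w
    ... | _ , P , _ , |P|≤|w| = ≤-trans (≤-reflexive (D-path P)) (∸-monoˡ-≤ 1 |P|≤|w|)

    D-refl : ∀ u → D u u ≡ 0
    D-refl u = D-path ([ u ] , [] ∷ [])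

    D-adj : ∀ {u v} → Adj u v → D u v ≡ 1
    D-adj {u} {v} e = D-path (e ∷ [ v ] , (adj⇒≢ e ∷ []) ∷ [] ∷ [])

    D≡0⇒≡ : ∀ {u v} → D u v ≡ 0 → u ≡ v
    D≡0⇒≡ {u} {v} D≡0 with connected u v
    ... | _ , ([ _ ] , _)    = refl
    ... | _ , P@(_ ∷ w , _) = contradiction (trans (sym (walk-length≡ w)) (trans (sym (D-path P)) D≡0)) (λ ())

    D≤n∸1 : ∀ u v → D u v ≤ n ∸ 1
    D≤n∸1 u v with connected u v
    ... | ps , P = ≤-trans (≤-reflexive (D-path P)) (∸-monoˡ-≤ 1 (unique⇒length≤ ps (proj₂ P)))

    D-sym : ∀ u v → D u v ≡ D v u
    D-sym u v = ≤-antisym (D-reverse v u) (D-reverse u v)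
      where
      D-reverse : ∀ u v → D v u ≤ D u v
      D-reverse u v with connected u v
      ... | ps , (w , w-unique) = begin
        D v u                      ≤⟨ D-walk (reverseʷ w) ⟩
        length (reverse ps) ∸ 1    ≡⟨ cong (_∸ 1) (length-reverse ps) ⟩
        pathLength ps              ≡⟨ D-path (w , w-unique) ⟨
        D u v                      ∎
        where open ≤-Reasoning

    D-triangle : ∀ u c v → D u v ≤ D u c + D c v
    D-triangle u c v with connected u c | connected c v
    ... | ps , (p , p-unique) | qs , (q , q-unique) = begin
      D u v                                      ≤⟨ D-walk (p ++ʷ q) ⟩
      length (ps ++ drop 1 qs) ∸ 1               ≡⟨ cong (_∸ 1) (length-++ ps) ⟩
      length ps + length (drop 1 qs) ∸ 1         ≡⟨ cong₂ (λ a b → a + b ∸ 1) (walk-length≡ p) (length-drop 1 qs) ⟩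
      pathLength ps + pathLength qs              ≡⟨ cong₂ _+_ (D-path (p , p-unique)) (D-path (q , q-unique)) ⟨
      D u c + D c v                              ∎
      where open ≤-Reasoning

    D-further : ∀ {m a x ps} → Adj m a → IsPath Adj m x ps → (∀ qs → ps ≢ m ∷ a ∷ qs) → D a x ≡ D m x + 1
    D-further {m} {a} {x} {ps} e P@(w , ps-unique) avoids-a with a ∈? ps
    ... | no a∉ps = begin
      D a x              ≡⟨ D-path (adj-sym e ∷ w , ¬Any⇒All¬ ps a∉ps ∷ ps-unique) ⟩
      length ps          ≡⟨ walk-length≡ w ⟩
      suc (pathLength ps) ≡⟨ +-comm 1 _ ⟩
      pathLength ps + 1  ≡⟨ cong (_+ 1) (D-path P) ⟨
      D m x + 1          ∎
      where open ≡-Reasoning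
    ... | yes a∈ps = let qs , ps≡ = passes-a w ps-unique a∈ps in contradiction ps≡ (avoids-a qs)
      where
      passes-a : ∀ {ps} → Walk Adj m x ps → Unique ps → a ∈ ps → ∃ λ qs → ps ≡ m ∷ a ∷ qs
      passes-a [ _ ]   _ (here a≡m) = ⊥-elim (adj⇒≢ e (sym a≡m))
      passes-a (_ ∷ _) _ (here a≡m) = ⊥-elim (adj⇒≢ e (sym a≡m))
      passes-a (f ∷ q) (m∉qs ∷ qs-unique) (there a∈qs) with suffixʷ q a∈qs
      ... | rs , r , rs⊆qs , _ , r-unique with walk-starts r
      ...   | rs′ , refl = rs′ , path-unique (f ∷ q , m∉qs ∷ qs-unique)
                                  (e ∷ r , All.tabulate (λ y∈rs → All.lookup m∉qs (rs⊆qs y∈rs)) ∷ r-unique qs-unique)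

    -- The m–x path leaves m through at most one of a and c.
    D-some-neighbour-further : ∀ {m a c} → Adj m a → Adj m c → a ≢ c → ∀ x → D a x ≡ D m x + 1 ⊎ D c x ≡ D m x + 1
    D-some-neighbour-further {m} {a} {c} ea ec a≢c x with connected m x
    ... | _ , P@([ _ ] , _) = inj₁ (D-further ea P (λ _ ()))
    ... | _ , P@(_∷_ {w = y} _ q , _) with walk-starts q | y ≟ᶠ a
    ...   | qs , refl | yes refl = inj₂ (D-further ec P (λ { _ refl → a≢c refl }))
    ...   | qs , refl | no  y≢a  = inj₁ (D-further ea P (λ { _ refl → y≢a refl }))

    D-convex : ∀ {m a c} → Adj m a → Adj m c → a ≢ c → ∀ x → D m x + D m x ≤ D a x + D c x
    D-convex {m} {a} {c} ea ec a≢c x = [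
      (λ Da≡ → subst (D m x + D m x ≤_) (+-comm (D c x) (D a x)) (one-further-one-nearer Da≡ (near ec))) ,
      (λ Dc≡ → one-further-one-nearer Dc≡ (near ea)) ]′ (D-some-neighbour-further ea ec a≢c x)
      where
      near : ∀ {b} → Adj m b → D m x ≤ 1 + D b x
      near {b} e = subst (λ k → D m x ≤ k + D b x) (D-adj e) (D-triangle m b x)
      one-further-one-nearer : ∀ {M A C} → A ≡ M + 1 → M ≤ 1 + C → M + M ≤ C + A
      one-further-one-nearer {M} {_} {C} refl M≤1+C = ≤-trans (+-monoˡ-≤ M M≤1+C) (≤-reflexive (shuffle M C))
        where shuffle : ∀ M C → 1 + C + M ≡ C + (M + 1)
              shuffle = solve-∀

    distanceSum : Fin n → ℕ
    distanceSum v = ∑[ u < n ] D v u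

    distanceSum-convex : ∀ {m a c} → Adj m a → Adj m c → a ≢ c →
      distanceSum m + distanceSum m + 2 ≤ distanceSum a + distanceSum c
    distanceSum-convex {m} {a} {c} ea ec a≢c = begin
      distanceSum m + distanceSum m + 2   ≡⟨ cong (_+ 2) (∑.∑-distrib-+ (D m) (D m)) ⟨
      ∑[ x < n ] (D m x + D m x) + 2      ≤⟨ ∑-mono-excess m (D-convex ea ec a≢c) at-m ⟩
      ∑[ x < n ] (D a x + D c x)          ≡⟨ ∑.∑-distrib-+ (D a) (D c) ⟩
      distanceSum a + distanceSum c       ∎
      where
      open ≤-Reasoning
      at-m : D m m + D m m + 2 ≤ D a m + D c m
      at-m rewrite D-refl m | D-adj (adj-sym ea) | D-adj (adj-sym ec) = ≤-refl

    distanceSum-step : ∀ {a b c} → Adj a b → Adj b c → a ≢ c → distanceSum a ≤ distanceSum b →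
      distanceSum b < distanceSum c
    distanceSum-step {a} {b} {c} eab ebc a≢c σa≤σb = +-cancelˡ-≤ (distanceSum b) _ _ (begin
      distanceSum b + suc (distanceSum b)     ≤⟨ +-monoʳ-≤ (distanceSum b) (n≤1+n _) ⟩
      distanceSum b + (2 + distanceSum b)      ≡⟨ cong (λ σ → distanceSum b + σ) (+-comm 2 (distanceSum b)) ⟩
      distanceSum b + (distanceSum b + 2)      ≡⟨ +-assoc (distanceSum b) _ 2 ⟨
      distanceSum b + distanceSum b + 2        ≤⟨ distanceSum-convex (adj-sym eab) ebc a≢c ⟩
      distanceSum a + distanceSum c            ≤⟨ +-monoˡ-≤ (distanceSum c) σa≤σb ⟩
      distanceSum b + distanceSum c            ∎)
      where open ≤-Reasoning

    distanceSum-increasing : ∀ {a b c v ps} → Adj a b → Adj b c → Walk Adj c v ps → Unique (a ∷ b ∷ ps) →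
      distanceSum a ≤ distanceSum b → distanceSum a < distanceSum v
    distanceSum-increasing eab ebc [ _ ] ((_ ∷ a≢c ∷ []) ∷ _) σa≤σb =
      ≤-<-trans σa≤σb (distanceSum-step eab ebc a≢c σa≤σb)
    distanceSum-increasing eab ebc (ecd ∷ w) ((_ ∷ a≢c ∷ _) ∷ b∉ps ∷ ps-unique) σa≤σb =
      ≤-<-trans σa≤σb (distanceSum-increasing ebc ecd w (b∉ps ∷ ps-unique) (<⇒≤ (distanceSum-step eab ebc a≢c σa≤σb)))

    minimisers-adjacent : ∀ {w w′} → (∀ u → distanceSum w ≤ distanceSum u) → (∀ u → distanceSum w′ ≤ distanceSum u) →
      w ≢ w′ → Adj w w′
    minimisers-adjacent {w} {w′} w-min w′-min w≢w′ with connected w w′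
    ... | _ , ([ _ ] , _)                = ⊥-elim (w≢w′ refl)
    ... | _ , (e ∷ [ _ ] , _)            = e
    ... | _ , (e ∷ e′ ∷ q , unique) =
      contradiction (w′-min w) (<⇒≱ (distanceSum-increasing e e′ q unique (w-min _)))

  module Centres (d D : Fin n → Fin n → ℕ) (isDistance : IsDistance Adj d) (isDetour : IsDetour Adj D) where

    open Detour D isDetour public

    d≡D : ∀ u v → d u v ≡ D u v
    d≡D u v with proj₁ (isDistance u v)
    ... | _ , P , |P|≡d = trans (sym |P|≡d) (sym (D-path P))

    weight≡distanceSum : ∀ v → weight d v ≡ distanceSum v
    weight≡distanceSum v = trans (sumV≡∑ (λ u → d u v)) (∑.sum-cong-≗ (λ u → trans (d≡D u v) (D-sym u v)))

    minimal? : ∀ v → Dec (∀ u → weight d v ≤ weight d u)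
    minimal? v = all? (λ u → weight d v ≤? weight d u)

    ∈centres⇒minimal : ∀ {v} → v ∈ centers d → ∀ u → distanceSum v ≤ distanceSum u
    ∈centres⇒minimal {v} v∈ u =
      subst₂ _≤_ (weight≡distanceSum v) (weight≡distanceSum u) (proj₂ (∈-filter⁻ minimal? {xs = allFin n} v∈) u)

    minimal⇒∈centres : ∀ {v} → (∀ u → distanceSum v ≤ distanceSum u) → v ∈ centers d
    minimal⇒∈centres {v} v-min =
      ∈-filter⁺ minimal? (∈-allFin v)
        (λ u → subst₂ _≤_ (sym (weight≡distanceSum v)) (sym (weight≡distanceSum u)) (v-min u))

    centres-adjacent : ∀ {a b} → a ∈ centers d → b ∈ centers d → a ≢ b → Adj a b
    centres-adjacent a∈ b∈ = minimisers-adjacent (∈centres⇒minimal a∈) (∈centres⇒minimal b∈)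

    centres-unique : Unique (centers d)
    centres-unique = filter⁺ minimal? (allFin⁺ n)

    some-centre : Fin n → ∃ λ w → w ∈ centers d
    some-centre v₀ = argmin distanceSum v₀ (allFin n) ,
      minimal⇒∈centres (λ u → All.lookup (f[argmin]≤f[xs] v₀ (allFin n)) (∈-allFin u))

    adjacent-in : ∀ {cs a b} → centers d ≡ cs → a ∈ cs → b ∈ cs → a ≢ b → Adj a b
    adjacent-in eq a∈ b∈ = centres-adjacent (subst (_ ∈_) (sym eq) a∈) (subst (_ ∈_) (sym eq) b∈)

    data Shape : Set where
      one : ∀ w → centers d ≡ w ∷ [] → Shape
      two : ∀ w w′ → centers d ≡ w ∷ w′ ∷ [] → Adj w w′ → Shape

    shape : Fin n → Shape
    shape v₀ with centers d in eq
    ... | [] = case subst (_ ∈_) eq (proj₂ (some-centre v₀)) of λ ()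
    ... | w ∷ [] = one w eq
    ... | w ∷ w′ ∷ [] with subst Unique eq centres-unique
    ...   | (w≢w′ ∷ []) ∷ _ = two w w′ eq (adjacent-in eq (here refl) (there (here refl)) w≢w′)
    shape v₀ | w ∷ w′ ∷ w″ ∷ _ with subst Unique eq centres-unique
    ...   | (w≢w′ ∷ w≢w″ ∷ _) ∷ (w′≢w″ ∷ _) ∷ _ =
      ⊥-elim (acyclic (w , w″ , w ∷ w′ ∷ w″ ∷ [] , triangle , ≤-refl , w″-w))
      where
      w″-w : Adj w″ w
      w″-w = adjacent-in eq (there (there (here refl))) (here refl) (w≢w″ ∘ sym)
      triangle : IsPath Adj w w″ (w ∷ w′ ∷ w″ ∷ [])
      triangle = adjacent-in eq (here refl) (there (here refl)) w≢w′
               ∷ adjacent-in eq (there (here refl)) (there (there (here refl))) w′≢w″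
               ∷ [ w″ ]
               , (w≢w′ ∷ w≢w″ ∷ []) ∷ (w′≢w″ ∷ []) ∷ [] ∷ []

    𝓛-from-centres : ∀ {cs} → centers d ≡ cs → ∀ u → 𝓛 d D u ≡ minList (map (D u) cs)
    𝓛-from-centres eq u = cong (λ cs → minList (map (D u) cs)) eq

    centres-count : Fin n → length (centers d) ≡ 1 ⊎ length (centers d) ≡ 2
    centres-count v with shape v
    ... | one _ eq     = inj₁ (cong length eq)
    ... | two _ _ eq _ = inj₂ (cong length eq)

    centres-close : ∀ {a b} → a ∈ centers d → b ∈ centers d → D a b ≤ ζ d
    centres-close {a} {b} a∈ b∈ with a ≟ᶠ b
    ... | yes refl = subst (_≤ ζ d) (sym (D-refl a)) z≤n
    ... | no  a≢b with shape a
    ...   | one w eq = ⊥-elim (a≢b (trans (is-w a∈) (sym (is-w b∈))))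
      where is-w : ∀ {x} → x ∈ centers d → x ≡ w
            is-w x∈ with subst (_ ∈_) eq x∈
            ... | here x≡w = x≡w
    ...   | two _ _ eq _ = ≤-reflexive (trans (D-adj (centres-adjacent a∈ b∈ a≢b)) (sym (ζ-two d (cong length eq))))

    𝓛-attained : ∀ u → ∃ λ a → a ∈ centers d × 𝓛 d D u ≡ D u a
    𝓛-attained u with shape u
    ... | one w eq = w , subst (w ∈_) (sym eq) (here refl) , 𝓛-from-centres eq u
    ... | two w w′ eq _ with minList-map-attained (D u) w (w′ ∷ [])
    ...   | a , a∈ , min≡ = a , subst (a ∈_) (sym eq) a∈ , trans (𝓛-from-centres eq u) min≡

    D≤𝓛+𝓛+ζ : ∀ u v → D u v ≤ 𝓛 d D u + 𝓛 d D v + ζ d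
    D≤𝓛+𝓛+ζ u v with 𝓛-attained u | 𝓛-attained v
    ... | a , a∈ , 𝓛u≡ | b , b∈ , 𝓛v≡ = begin
      D u v                     ≤⟨ D-triangle u a v ⟩
      D u a + D a v             ≤⟨ +-monoʳ-≤ (D u a) (D-triangle a b v) ⟩
      D u a + (D a b + D b v)   ≤⟨ +-monoʳ-≤ (D u a) (+-monoˡ-≤ (D b v) (centres-close a∈ b∈)) ⟩
      D u a + (ζ d + D b v)     ≡⟨ shuffle (D u a) (ζ d) (D b v) ⟩
      D u a + D b v + ζ d       ≡⟨ cong₂ (λ p q → p + q + ζ d) (sym 𝓛u≡) (trans (D-sym b v) (sym 𝓛v≡)) ⟩
      𝓛 d D u + 𝓛 d D v + ζ d   ∎
      where
      open ≤-Reasoning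
      shuffle : ∀ p z q → p + (z + q) ≡ p + q + z
      shuffle = solve-∀

    ζ′≤𝓛+𝓛 : ∀ u v → u ≢ v → ζ′ d ≤ 𝓛 d D u + 𝓛 d D v
    ζ′≤𝓛+𝓛 u v u≢v with shape u
    ... | two _ _ eq _ = subst (_≤ 𝓛 d D u + 𝓛 d D v) (sym (cong (1 ∸_) (ζ-two d (cong length eq)))) z≤n
    ... | one w eq = subst (_≤ 𝓛 d D u + 𝓛 d D v) (sym (cong (1 ∸_) (ζ-one d (cong length eq))))
      (n≢0⇒n>0 λ sum≡0 → u≢v (trans (is-w u (m+n≡0⇒m≡0 _ sum≡0)) (sym (is-w v (m+n≡0⇒n≡0 _ sum≡0)))))
      where is-w : ∀ x → 𝓛 d D x ≡ 0 → x ≡ w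
            is-w x 𝓛x≡0 = D≡0⇒≡ (trans (sym (𝓛-from-centres eq x)) 𝓛x≡0)

-- Hamiltonian colourings along an ordering

open import Data.Integer as ℤ using (ℤ; +_; +≤+)
import Data.Integer.Properties as ℤ
open import Data.Integer.Tactic.RingSolver using () renaming (solve-∀ to solve-∀ᶻ)

stepwise-mono : ∀ {f : ℕ → ℤ} {m} → (∀ t → suc t ≤ m → f t ℤ.≤ f (suc t)) →
  ∀ {a b} → a ≤ b → b ≤ m → f a ℤ.≤ f b
stepwise-mono step {b = zero}  z≤n   _     = ℤ.≤-refl
stepwise-mono step {b = suc b} a≤1+b 1+b≤m with m≤n⇒m<n∨m≡n a≤1+b
... | inj₁ a<1+b = ℤ.≤-trans (stepwise-mono step (≤-pred a<1+b) (≤-trans (n≤1+n b) 1+b≤m)) (step b 1+b≤m)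
... | inj₂ refl  = ℤ.≤-refl

pos-∸ : ∀ {a b} → a ≤ b → + (b ∸ a) ≡ + b ℤ.- + a
pos-∸ {a} {b} a≤b = sym (trans (ℤ.m-n≡m⊖n b a) (ℤ.⊖-≥ a≤b))

≤-by-difference : ∀ {x y x′ y′ : ℤ} → x ℤ.≤ y → y ℤ.- x ≡ y′ ℤ.- x′ → x′ ℤ.≤ y′
≤-by-difference x≤y diff = ℤ.0≤i-j⇒j≤i (subst (ℤ.0ℤ ℤ.≤_) diff (ℤ.i≤j⇒0≤j-i x≤y))

endCond⇒ends : ∀ {n} (d D : Fin n → Fin n → ℕ) x → length (centers d) ≡ 1 ⊎ length (centers d) ≡ 2 →
  EndCond d D x → Lseq d D x 0 + Lseq d D x (n ∸ 1) ≡ ζ′ d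
endCond⇒ends d D x (inj₁ one) (ends , _) =
  trans (cong₂ _+_ (proj₁ (ends one)) (proj₂ (ends one))) (sym (cong (1 ∸_) (ζ-one d one)))
endCond⇒ends d D x (inj₂ two) (_ , ends) =
  trans (cong₂ _+_ (proj₁ (ends two)) (proj₂ (ends two))) (sym (cong (1 ∸_) (ζ-two d two)))

ends⇒endCond : ∀ {n} (d D : Fin n → Fin n → ℕ) x → Lseq d D x 0 + Lseq d D x (n ∸ 1) ≡ ζ′ d →
  Lseq d D x 0 ≡ 0 → EndCond d D x
ends⇒endCond {n} d D x ends first≡0 =
  (λ one → first≡0 , trans last≡ζ′ (cong (1 ∸_) (ζ-one d one))) ,
  (λ two → first≡0 , trans last≡ζ′ (cong (1 ∸_) (ζ-two d two)))
  where last≡ζ′ : Lseq d D x (n ∸ 1) ≡ ζ′ d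
        last≡ζ′ = trans (cong (_+ Lseq d D x (n ∸ 1)) (sym first≡0)) ends

module Hamiltonian (m : ℕ) (d D : Fin (suc m) → Fin (suc m) → ℕ) (1≤m : 1 ≤ m)
  (D-sym : ∀ u v → D u v ≡ D v u)
  (D≤m : ∀ u v → D u v ≤ m)
  (D≤𝓛+𝓛+ζ : ∀ u v → D u v ≤ 𝓛 d D u + 𝓛 d D v + ζ d)
  (ζ′≤𝓛+𝓛 : ∀ u v → u ≢ v → ζ′ d ≤ 𝓛 d D u + 𝓛 d D v)
  (centres-count : length (centers d) ≡ 1 ⊎ length (centers d) ≡ 2)
  where

  -- With n = suc m, the n ∸ 1 of the definitions is m definitionally.

  L : Fin (suc m) → ℕ
  L = 𝓛 d D

  s : ℕ
  s = m ∸ ζ d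

  +s≡+m-+ζ : + s ≡ + m ℤ.- + ζ d
  +s≡+m-+ζ = pos-∸ (≤-trans (ζ≤1 d) 1≤m)

  last : Fin (suc m)
  last = Fin.fromℕ m

  colouring : Fin (suc m) ↔ Fin (suc m) → Fin (suc m) → ℕ
  colouring x v = ℤ.∣ hOrd d D x v ∣

  module Along (x : Fin (suc m) ↔ Fin (suc m)) where

    vertex : Fin (suc m) → Fin (suc m)
    vertex = Inverse.to x

    position : Fin (suc m) → Fin (suc m)
    position = Inverse.from x

    vertex-position : ∀ v → vertex (position v) ≡ v
    vertex-position = Inverse.strictlyInverseˡ x

    position-vertex : ∀ i → position (vertex i) ≡ i
    position-vertex = Inverse.strictlyInverseʳ x

    vertex-injective : ∀ {i j} → vertex i ≡ vertex j → i ≡ j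
    vertex-injective {i} {j} eq = trans (sym (position-vertex i)) (trans (cong position eq) (position-vertex j))

    ℓ : ℕ → ℕ
    ℓ = Lseq d D x

    pair : ℕ → ℕ
    pair t = ℓ t + ℓ (suc t)

    H : ℕ → ℤ
    H = hseq d D x

    ℓ-vertex : ∀ i → ℓ (toℕ i) ≡ L (vertex i)
    ℓ-vertex = extℕ-toℕ (L ∘ vertex)

    ℓ-last : ℓ m ≡ L (vertex last)
    ℓ-last = subst (λ k → ℓ k ≡ L (vertex last)) (toℕ-fromℕ m) (ℓ-vertex last)

    H-closed : ∀ k → H k ≡ + (k * s) ℤ.- + sumFrom pair 0 k
    H-closed zero    = refl
    H-closed (suc k) = begin
      H k ℤ.+ + s ℤ.- + ℓ k ℤ.- + ℓ (suc k)
        ≡⟨ cong (λ z → z ℤ.+ + s ℤ.- + ℓ k ℤ.- + ℓ (suc k)) (H-closed k) ⟩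
      + (k * s) ℤ.- + S ℤ.+ + s ℤ.- + ℓ k ℤ.- + ℓ (suc k)
        ≡⟨ regroup (+ (k * s)) (+ S) (+ s) (+ ℓ k) (+ ℓ (suc k)) ⟩
      (+ s ℤ.+ + (k * s)) ℤ.- (+ S ℤ.+ (+ ℓ k ℤ.+ + ℓ (suc k)))
        ≡⟨ cong₂ ℤ._-_ (ℤ.pos-+ s (k * s))
                       (trans (ℤ.pos-+ S (pair k)) (cong (λ z → + S ℤ.+ z) (ℤ.pos-+ (ℓ k) (ℓ (suc k))))) ⟨
      + (suc k * s) ℤ.- + (S + pair k)
        ≡⟨ cong (λ z → + (suc k * s) ℤ.- + z) (sumFrom-snoc pair 0 k) ⟨
      + (suc k * s) ℤ.- + sumFrom pair 0 (suc k) ∎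
      where
      open ≡-Reasoning
      S : ℕ
      S = sumFrom pair 0 k
      regroup : ∀ a b c e f → a ℤ.- b ℤ.+ c ℤ.- e ℤ.- f ≡ (c ℤ.+ a) ℤ.- (b ℤ.+ (e ℤ.+ f))
      regroup = solve-∀ᶻ

    H-difference : ∀ i k → H (i + k) ℤ.- H i ≡ + (k * s) ℤ.- + sumFrom pair i k
    H-difference i k = begin
      H (i + k) ℤ.- H i
        ≡⟨ cong₂ ℤ._-_ (H-closed (i + k)) (H-closed i) ⟩
      (+ ((i + k) * s) ℤ.- + sumFrom pair 0 (i + k)) ℤ.- (+ (i * s) ℤ.- + sumFrom pair 0 i)
        ≡⟨ cong₂ (λ a b → (+ a ℤ.- + b) ℤ.- (+ (i * s) ℤ.- + sumFrom pair 0 i))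
                 (*-distribʳ-+ s i k) (sumFrom-+ pair 0 i k) ⟩
      (+ (i * s + k * s) ℤ.- + (sumFrom pair 0 i + sumFrom pair i k)) ℤ.- (+ (i * s) ℤ.- + sumFrom pair 0 i)
        ≡⟨ cong₂ (λ a b → (a ℤ.- b) ℤ.- (+ (i * s) ℤ.- + sumFrom pair 0 i))
                 (ℤ.pos-+ (i * s) (k * s)) (ℤ.pos-+ (sumFrom pair 0 i) (sumFrom pair i k)) ⟩
      (+ (i * s) ℤ.+ + (k * s) ℤ.- (+ sumFrom pair 0 i ℤ.+ + sumFrom pair i k)) ℤ.- (+ (i * s) ℤ.- + sumFrom pair 0 i)
        ≡⟨ cancel (+ (i * s)) (+ (k * s)) (+ sumFrom pair 0 i) (+ sumFrom pair i k) ⟩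
      + (k * s) ℤ.- + sumFrom pair i k ∎
      where
      open ≡-Reasoning
      cancel : ∀ a b c e → (a ℤ.+ b ℤ.- (c ℤ.+ e)) ℤ.- (a ℤ.- c) ≡ b ℤ.- e
      cancel = solve-∀ᶻ

    distCond-lhs : ∀ i j → i ≤ j →
      + sumRange pair i j ℤ.- + (j ∸ i) ℤ.* + s ℤ.+ + m ≡ + m ℤ.- (H j ℤ.- H i)
    distCond-lhs i j i≤j = begin
      + sumFrom pair i k ℤ.- + k ℤ.* + s ℤ.+ + m   ≡⟨ cong (λ z → + sumFrom pair i k ℤ.- z ℤ.+ + m) (ℤ.pos-* k s) ⟨
      + sumFrom pair i k ℤ.- + (k * s) ℤ.+ + m     ≡⟨ rearrange (+ sumFrom pair i k) (+ (k * s)) (+ m) ⟩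
      + m ℤ.- (+ (k * s) ℤ.- + sumFrom pair i k)   ≡⟨ cong (λ z → + m ℤ.- z) (H-difference i k) ⟨
      + m ℤ.- (H (i + k) ℤ.- H i)                  ≡⟨ cong (λ z → + m ℤ.- (H z ℤ.- H i)) (m+[n∸m]≡n i≤j) ⟩
      + m ℤ.- (H j ℤ.- H i)                        ∎
      where
      open ≡-Reasoning
      k : ℕ
      k = j ∸ i
      rearrange : ∀ a b c → a ℤ.- b ℤ.+ c ≡ c ℤ.- (b ℤ.- a)
      rearrange = solve-∀ᶻ

    ends-pairSum : sumFrom pair 0 m + ℓ 0 + ℓ m ≡ 2 * 𝓛W d D
    ends-pairSum = begin
      sumFrom pair 0 m + ℓ 0 + ℓ m       ≡⟨ sumFrom-adjacentPairs ℓ 0 m ⟩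
      2 * sumFrom ℓ 0 (suc m)            ≡⟨ cong (2 *_) (begin
        sumFrom ℓ 0 (suc m)              ≡⟨ sumFrom-extℕ (L ∘ vertex) ⟩
        ∑[ i < suc m ] L (vertex i)      ≡⟨ ∑.sum-permute L x ⟨
        ∑[ i < suc m ] L i               ≡⟨ sumV≡∑ L ⟨
        𝓛W d D                           ∎) ⟩
      2 * 𝓛W d D                         ∎
      where open ≡-Reasoning

    H-last : H m ≡ hcFormula d D ℤ.+ (+ (ℓ 0 + ℓ m) ℤ.- + ζ′ d)
    H-last = begin
      H m                                          ≡⟨ H-closed m ⟩
      + (m * s) ℤ.- + S                            ≡⟨ cong (λ z → z ℤ.- + S) (ℤ.pos-* m s) ⟩
      + m ℤ.* + s ℤ.- + S                          ≡⟨ regroup (+ m ℤ.* + s) (+ S) (+ e) (+ ζ′ d) ⟩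
      + m ℤ.* + s ℤ.+ + ζ′ d ℤ.- (+ S ℤ.+ + e) ℤ.+ (+ e ℤ.- + ζ′ d)
        ≡⟨ cong (λ z → + m ℤ.* + s ℤ.+ + ζ′ d ℤ.- z ℤ.+ (+ e ℤ.- + ζ′ d)) twice-𝓛W ⟩
      hcFormula d D ℤ.+ (+ e ℤ.- + ζ′ d)           ∎
      where
      open ≡-Reasoning
      S e : ℕ
      S = sumFrom pair 0 m
      e = ℓ 0 + ℓ m
      twice-𝓛W : + S ℤ.+ + e ≡ + 2 ℤ.* + 𝓛W d D
      twice-𝓛W = begin
        + S ℤ.+ + e         ≡⟨ ℤ.pos-+ S e ⟨
        + (S + e)           ≡⟨ cong +_ (trans (sym (+-assoc S (ℓ 0) (ℓ m))) ends-pairSum) ⟩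
        + (2 * 𝓛W d D)      ≡⟨ ℤ.pos-* 2 (𝓛W d D) ⟩
        + 2 ℤ.* + 𝓛W d D    ∎
      regroup : ∀ a b c z → a ℤ.- b ≡ a ℤ.+ z ℤ.- (b ℤ.+ c) ℤ.+ (c ℤ.- z)
      regroup = solve-∀ᶻ

    ζ′≤ends : ζ′ d ≤ ℓ 0 + ℓ m
    ζ′≤ends = subst₂ (λ a b → ζ′ d ≤ a + b) (sym (ℓ-vertex Fin.zero)) (sym ℓ-last)
      (ζ′≤𝓛+𝓛 _ _ (λ eq → <⇒≢ 1≤m (trans (cong toℕ (vertex-injective eq)) (toℕ-fromℕ m))))

    formula≤H-last : hcFormula d D ℤ.≤ H m
    formula≤H-last = ≤-by-difference (+≤+ ζ′≤ends) (sym (trans (cong (ℤ._- hcFormula d D) H-last) (cancel (hcFormula d D) _)))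
      where cancel : ∀ f δ → f ℤ.+ δ ℤ.- f ≡ δ
            cancel = solve-∀ᶻ

    module SortedColouring (h : Fin (suc m) → ℕ) (ham : IsHamColoring D h) (sorted : SortedBy h x) where

      A : ℕ → ℕ
      A = extℕ (h ∘ vertex)

      gap : ∀ i j → toℕ i < toℕ j → m + h (vertex i) ≤ D (vertex i) (vertex j) + h (vertex j)
      gap i j i<j = +∣-∣⇒+ (sorted (<⇒≤ i<j)) (ham _ _ (λ eq → <⇒≢ i<j (cong toℕ (vertex-injective eq))))

      consecutive-gap : ∀ t → suc t ≤ m → m + A t ≤ ℓ t + ℓ (suc t) + ζ d + A (suc t)
      consecutive-gap t t<m = begin
        m + A t
          ≡⟨ cong (λ a → m + a) (extℕ-fromℕ< (h ∘ vertex) t<n) ⟩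
        m + h (vertex i)
          ≤⟨ gap i j (subst₂ _<_ (sym (toℕ-fromℕ< t<n)) (sym (toℕ-fromℕ< t+1<n)) (n<1+n t)) ⟩
        D (vertex i) (vertex j) + h (vertex j)
          ≤⟨ +-monoˡ-≤ (h (vertex j)) (D≤𝓛+𝓛+ζ (vertex i) (vertex j)) ⟩
        L (vertex i) + L (vertex j) + ζ d + h (vertex j)
          ≡⟨ cong₂ (λ a b → a + b + ζ d + h (vertex j)) (extℕ-fromℕ< (L ∘ vertex) t<n) (extℕ-fromℕ< (L ∘ vertex) t+1<n) ⟨
        ℓ t + ℓ (suc t) + ζ d + h (vertex j)
          ≡⟨ cong (λ a → ℓ t + ℓ (suc t) + ζ d + a) (extℕ-fromℕ< (h ∘ vertex) t+1<n) ⟨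
        ℓ t + ℓ (suc t) + ζ d + A (suc t) ∎
        where
        open ≤-Reasoning
        t<n : t < suc m
        t<n = s≤s (<⇒≤ t<m)
        t+1<n : suc t < suc m
        t+1<n = s≤s t<m
        i j : Fin (suc m)
        i = fromℕ< t<n
        j = fromℕ< t+1<n

      slack : ℕ → ℤ
      slack t = + A t ℤ.- H t

      slack-step : ∀ t → suc t ≤ m → slack t ℤ.≤ slack (suc t)
      slack-step t t<m = ≤-by-difference (+≤+ (consecutive-gap t t<m)) (begin
        + (ℓ t + ℓ (suc t) + ζ d + A (suc t)) ℤ.- + (m + A t)
          ≡⟨ cong₂ ℤ._-_ (expand (ℓ t) (ℓ (suc t)) (ζ d) (A (suc t))) (ℤ.pos-+ m (A t)) ⟩
        + ℓ t ℤ.+ + ℓ (suc t) ℤ.+ + ζ d ℤ.+ + A (suc t) ℤ.- (+ m ℤ.+ + A t)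
          ≡⟨ regroup (+ ℓ t) (+ ℓ (suc t)) (+ ζ d) (+ A (suc t)) (+ m) (+ A t) (H t) ⟩
        (+ A (suc t) ℤ.- (H t ℤ.+ (+ m ℤ.- + ζ d) ℤ.- + ℓ t ℤ.- + ℓ (suc t))) ℤ.- slack t
          ≡⟨ cong (λ z → (+ A (suc t) ℤ.- (H t ℤ.+ z ℤ.- + ℓ t ℤ.- + ℓ (suc t))) ℤ.- slack t) +s≡+m-+ζ ⟨
        slack (suc t) ℤ.- slack t ∎)
        where
        open ≡-Reasoning
        expand : ∀ a b c e → + (a + b + c + e) ≡ + a ℤ.+ + b ℤ.+ + c ℤ.+ + e
        expand a b c e =
          trans (ℤ.pos-+ (a + b + c) e) (cong (ℤ._+ + e) (trans (ℤ.pos-+ (a + b) c) (cong (ℤ._+ + c) (ℤ.pos-+ a b))))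
        regroup : ∀ a b z q k p h →
          a ℤ.+ b ℤ.+ z ℤ.+ q ℤ.- (k ℤ.+ p) ≡ (q ℤ.- (h ℤ.+ (k ℤ.- z) ℤ.- a ℤ.- b)) ℤ.- (p ℤ.- h)
        regroup = solve-∀ᶻ

      slack-mono : ∀ {a b} → a ≤ b → b ≤ m → slack a ℤ.≤ slack b
      slack-mono = stepwise-mono slack-step

      A-last : A m ≡ h (vertex last)
      A-last = subst (λ k → A k ≡ h (vertex last)) (toℕ-fromℕ m) (extℕ-toℕ (h ∘ vertex) last)

      rise≤span : + A m ℤ.- + A 0 ℤ.≤ + span h
      rise≤span = subst (ℤ._≤ + span h) rise≡ (+≤+ (∣-∣≤span h (vertex Fin.zero) (vertex last)))
        where
        first≤last : A 0 ≤ A m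
        first≤last = subst (A 0 ≤_) (sym A-last) (sorted {Fin.zero} {last} z≤n)
        rise≡ : + ∣ h (vertex Fin.zero) - h (vertex last) ∣ ≡ + A m ℤ.- + A 0
        rise≡ = trans (cong (λ a → + ∣ A 0 - a ∣) (sym A-last))
                      (trans (cong +_ (m≤n⇒∣m-n∣≡n∸m first≤last)) (pos-∸ first≤last))

      H-last≤rise : H m ℤ.≤ + A m ℤ.- + A 0
      H-last≤rise = ≤-by-difference (slack-mono z≤n ≤-refl) (regroup (+ A m) (H m) (+ A 0))
        where regroup : ∀ a h a₀ → (a ℤ.- h) ℤ.- (a₀ ℤ.- + 0) ≡ (a ℤ.- a₀) ℤ.- h
              regroup = solve-∀ᶻ

      lowerBound : hcFormula d D ℤ.≤ + span h
      lowerBound = ℤ.≤-trans formula≤H-last (ℤ.≤-trans H-last≤rise rise≤span)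

      H-rise : ∀ i j → slack (toℕ i) ≡ slack (toℕ j) → H (toℕ j) ℤ.- H (toℕ i) ≡ + h (vertex j) ℤ.- + h (vertex i)
      H-rise i j same-slack = begin
        H (toℕ j) ℤ.- H (toℕ i)
          ≡⟨ unfold (+ A (toℕ j)) (H (toℕ j)) (+ A (toℕ i)) (H (toℕ i)) ⟩
        (+ A (toℕ j) ℤ.- + A (toℕ i)) ℤ.- (slack (toℕ j) ℤ.- slack (toℕ i))
          ≡⟨ cong (λ σ → (+ A (toℕ j) ℤ.- + A (toℕ i)) ℤ.- (σ ℤ.- slack (toℕ i))) same-slack ⟨
        (+ A (toℕ j) ℤ.- + A (toℕ i)) ℤ.- (slack (toℕ i) ℤ.- slack (toℕ i))
          ≡⟨ cancel (+ A (toℕ j) ℤ.- + A (toℕ i)) (slack (toℕ i)) ⟩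
        + A (toℕ j) ℤ.- + A (toℕ i)
          ≡⟨ cong₂ (λ a b → + a ℤ.- + b) (extℕ-toℕ (h ∘ vertex) j) (extℕ-toℕ (h ∘ vertex) i) ⟩
        + h (vertex j) ℤ.- + h (vertex i) ∎
        where
        open ≡-Reasoning
        unfold : ∀ a h b g → h ℤ.- g ≡ (a ℤ.- b) ℤ.- ((a ℤ.- h) ℤ.- (b ℤ.- g))
        unfold = solve-∀ᶻ
        cancel : ∀ δ σ → δ ℤ.- (σ ℤ.- σ) ≡ δ
        cancel = solve-∀ᶻ

      module Optimal (optimal : + span h ≡ hcFormula d D) where

        H-last≤formula : H m ℤ.≤ hcFormula d D
        H-last≤formula = subst (H m ℤ.≤_) optimal (ℤ.≤-trans H-last≤rise rise≤span)

        ends : ℓ 0 + ℓ m ≡ ζ′ d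
        ends = ≤-antisym (ℤ.drop‿+≤+ (≤-by-difference H-last≤formula difference)) ζ′≤ends
          where
          cancel : ∀ f e z → f ℤ.- (f ℤ.+ (e ℤ.- z)) ≡ z ℤ.- e
          cancel = solve-∀ᶻ
          difference : hcFormula d D ℤ.- H m ≡ + ζ′ d ℤ.- + (ℓ 0 + ℓ m)
          difference = trans (cong (λ z → hcFormula d D ℤ.- z) H-last) (cancel (hcFormula d D) (+ (ℓ 0 + ℓ m)) (+ ζ′ d))

        slack-constant : ∀ {a b} → a ≤ b → b ≤ m → slack a ≡ slack b
        slack-constant {a} {b} a≤b b≤m = ℤ.≤-antisym (slack-mono a≤b b≤m)
          (ℤ.≤-trans (slack-mono b≤m ≤-refl) (ℤ.≤-trans last≤first (slack-mono z≤n (≤-trans a≤b b≤m))))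
          where
          last≤first : slack m ℤ.≤ slack 0
          last≤first = ≤-by-difference (ℤ.≤-trans rise≤span (subst (ℤ._≤ H m) (sym optimal) formula≤H-last))
                         (regroup (+ A m) (+ A 0) (H m))
            where regroup : ∀ a a₀ h → h ℤ.- (a ℤ.- a₀) ≡ (a₀ ℤ.- + 0) ℤ.- (a ℤ.- h)
                  regroup = solve-∀ᶻ

        distCond : DistCond d D x
        distCond i j i<j = begin
          + sumRange pair (toℕ i) (toℕ j) ℤ.- + (toℕ j ∸ toℕ i) ℤ.* + s ℤ.+ + m
            ≡⟨ distCond-lhs (toℕ i) (toℕ j) (<⇒≤ i<j) ⟩
          + m ℤ.- (H (toℕ j) ℤ.- H (toℕ i))
            ≡⟨ cong (λ z → + m ℤ.- z) (H-rise i j (slack-constant (<⇒≤ i<j) (≤-pred (toℕ<n j)))) ⟩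
          + m ℤ.- (+ h (vertex j) ℤ.- + h (vertex i))
            ≤⟨ ≤-by-difference (+≤+ (gap i j i<j)) (regroup (D (vertex i) (vertex j)) (h (vertex j)) m (h (vertex i))) ⟩
          + D (vertex i) (vertex j) ∎
          where
          open ℤ.≤-Reasoning
          regroup : ∀ D b m a → + (D + b) ℤ.- + (m + a) ≡ + D ℤ.- (+ m ℤ.- (+ b ℤ.- + a))
          regroup D b m a = trans (cong₂ ℤ._-_ (ℤ.pos-+ D b) (ℤ.pos-+ m a)) (shuffle (+ D) (+ b) (+ m) (+ a))
            where shuffle : ∀ D b m a → D ℤ.+ b ℤ.- (m ℤ.+ a) ≡ D ℤ.- (m ℤ.- (b ℤ.- a))
                  shuffle = solve-∀ᶻ

    module FromDistCond (distCond : DistCond d D x) (ends : ℓ 0 + ℓ m ≡ ζ′ d) where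

      H-gap : ∀ i j → toℕ i < toℕ j → + m ℤ.- (H (toℕ j) ℤ.- H (toℕ i)) ℤ.≤ + D (vertex i) (vertex j)
      H-gap i j i<j = subst (ℤ._≤ + D (vertex i) (vertex j)) (distCond-lhs (toℕ i) (toℕ j) (<⇒≤ i<j)) (distCond i j i<j)

      H-nonneg : ∀ (i : Fin (suc m)) → + 0 ℤ.≤ H (toℕ i)
      H-nonneg Fin.zero      = ℤ.≤-refl
      H-nonneg (Fin.suc i) =
        ≤-by-difference (ℤ.≤-trans (H-gap Fin.zero (Fin.suc i) (s≤s z≤n)) (+≤+ (D≤m _ _))) (cancel (+ m) (H (suc (toℕ i))))
        where cancel : ∀ k h → k ℤ.- (k ℤ.- (h ℤ.- + 0)) ≡ h ℤ.- + 0
              cancel = solve-∀ᶻ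

      P : Fin (suc m) → ℕ
      P = colouring x

      P-vertex : ∀ i → + P (vertex i) ≡ H (toℕ i)
      P-vertex i rewrite position-vertex i = ℤ.0≤i⇒+∣i∣≡i (H-nonneg i)

      P-gap : ∀ i j → toℕ i < toℕ j → m + P (vertex i) ≤ D (vertex i) (vertex j) + P (vertex j)
      P-gap i j i<j = ℤ.drop‿+≤+ (≤-by-difference (H-gap i j i<j) (begin
        + D (vertex i) (vertex j) ℤ.- (+ m ℤ.- (H (toℕ j) ℤ.- H (toℕ i)))
          ≡⟨ cong₂ (λ b a → + D (vertex i) (vertex j) ℤ.- (+ m ℤ.- (b ℤ.- a))) (P-vertex j) (P-vertex i) ⟨
        + D (vertex i) (vertex j) ℤ.- (+ m ℤ.- (+ P (vertex j) ℤ.- + P (vertex i)))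
          ≡⟨ shuffle (+ D (vertex i) (vertex j)) (+ P (vertex j)) (+ m) (+ P (vertex i)) ⟩
        + D (vertex i) (vertex j) ℤ.+ + P (vertex j) ℤ.- (+ m ℤ.+ + P (vertex i))
          ≡⟨ cong₂ ℤ._-_ (ℤ.pos-+ (D (vertex i) (vertex j)) (P (vertex j))) (ℤ.pos-+ m (P (vertex i))) ⟨
        + (D (vertex i) (vertex j) + P (vertex j)) ℤ.- + (m + P (vertex i)) ∎))
        where
        open ≡-Reasoning
        shuffle : ∀ D b m a → D ℤ.- (m ℤ.- (b ℤ.- a)) ≡ D ℤ.+ b ℤ.- (m ℤ.+ a)
        shuffle = solve-∀ᶻ

      HamPair : Fin (suc m) → Fin (suc m) → Set
      HamPair a b = m ≤ D a b + ∣ P a - P b ∣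

      HamPair-sym : ∀ {a b} → HamPair a b → HamPair b a
      HamPair-sym {a} {b} = subst₂ (λ δ p → m ≤ δ + p) (D-sym a b) (∣-∣-comm (P a) (P b))

      HamPair-ordered : ∀ u v → toℕ (position u) < toℕ (position v) → HamPair u v
      HamPair-ordered u v i<j =
        subst₂ HamPair (vertex-position u) (vertex-position v) (proj₂ (+⇒+∣-∣ (D≤m _ _) (P-gap _ _ i<j)))

      hamiltonian : IsHamColoring D P
      hamiltonian u v u≢v with <-cmp (toℕ (position u)) (toℕ (position v))
      ... | tri< i<j _ _ = HamPair-ordered u v i<j
      ... | tri> _ _ j<i = HamPair-sym (HamPair-ordered v u j<i)
      ... | tri≈ _ i≡j _ =
        contradiction (trans (sym (vertex-position u)) (trans (cong vertex (toℕ-injective i≡j)) (vertex-position v))) u≢v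

      P-first : P (vertex Fin.zero) ≡ 0
      P-first = cong ℤ.∣_∣ (P-vertex Fin.zero)

      P≤P-last : ∀ v → P v ≤ P (vertex last)
      P≤P-last v with m≤n⇒m<n∨m≡n (≤-pred (toℕ<n (position v)))
      ... | inj₁ i<m = subst (λ a → P a ≤ P (vertex last)) (vertex-position v)
                         (proj₁ (+⇒+∣-∣ (D≤m _ _) (P-gap _ last (subst (toℕ (position v) <_) (sym (toℕ-fromℕ m)) i<m))))
      ... | inj₂ i≡m = ≤-reflexive (cong P (trans (sym (vertex-position v))
                         (cong vertex (toℕ-injective (trans i≡m (sym (toℕ-fromℕ m)))))))

      span≡formula : + span P ≡ hcFormula d D
      span≡formula = begin
        + span P                                          ≡⟨ cong +_ (span-between P (vertex Fin.zero) (vertex last) P-first P≤P-last) ⟩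
        + P (vertex last)                                 ≡⟨ P-vertex last ⟩
        H (toℕ last)                                      ≡⟨ cong H (toℕ-fromℕ m) ⟩
        H m                                               ≡⟨ H-last ⟩
        hcFormula d D ℤ.+ (+ (ℓ 0 + ℓ m) ℤ.- + ζ′ d)      ≡⟨ cong (λ e → hcFormula d D ℤ.+ (+ e ℤ.- + ζ′ d)) ends ⟩
        hcFormula d D ℤ.+ (+ ζ′ d ℤ.- + ζ′ d)             ≡⟨ cancel (hcFormula d D) (+ ζ′ d) ⟩
        hcFormula d D                                     ∎
        where
        open ≡-Reasoning
        cancel : ∀ f z → f ℤ.+ (z ℤ.- z) ≡ f
        cancel = solve-∀ᶻ

  reversed : Fin (suc m) ↔ Fin (suc m) → Fin (suc m) ↔ Fin (suc m)
  reversed x = x ↔-∘ Permutation.reverse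

  module Reflection (x : Fin (suc m) ↔ Fin (suc m)) (h : Fin (suc m) → ℕ) (ham : IsHamColoring D h) (sorted : SortedBy h x) where

    open Along x using (vertex; position; vertex-position; ℓ-last)

    top : ℕ
    top = h (vertex last)

    h′ : Fin (suc m) → ℕ
    h′ v = top ∸ h v

    h≤top : ∀ v → h v ≤ top
    h≤top v = subst (λ a → h a ≤ top) (vertex-position v)
      (sorted (subst (toℕ (position v) ≤_) (sym (toℕ-fromℕ m)) (≤-pred (toℕ<n (position v)))))

    ∣h′-h′∣ : ∀ u v → ∣ h′ u - h′ v ∣ ≡ ∣ h u - h v ∣
    ∣h′-h′∣ u v = ∣∸-∸∣ top (h≤top u) (h≤top v)

    ham′ : IsHamColoring D h′
    ham′ u v u≢v = subst (λ a → m ≤ D u v + a) (sym (∣h′-h′∣ u v)) (ham u v u≢v)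

    span′ : span h′ ≡ span h
    span′ = span-cong h′ h ∣h′-h′∣

    sorted′ : SortedBy h′ (reversed x)
    sorted′ {i} {j} i≤j =
      ∸-monoʳ-≤ top (sorted (subst₂ _≤_ (sym (opposite-prop j)) (sym (opposite-prop i)) (∸-monoʳ-≤ m i≤j)))

    first′ : Lseq d D (reversed x) 0 ≡ Lseq d D x m
    first′ = trans (extℕ-toℕ (L ∘ Inverse.to (reversed x)) Fin.zero) (sym ℓ-last)

  lowerBound : ∀ h → IsHamColoring D h → hcFormula d D ℤ.≤ + span h
  lowerBound h ham = Along.SortedColouring.lowerBound x h ham sorted
    where open Σ (sortingPermutation h) renaming (proj₁ to x; proj₂ to sorted)

  optimal⇒goodOrdering : ∀ h → IsHamColoring D h → + span h ≡ hcFormula d D → ∃ λ x → GoodOrdering d D x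
  optimal⇒goodOrdering h ham optimal = choose (Lseq d D x 0 ≟ 0)
    where
    open Σ (sortingPermutation h) renaming (proj₁ to x; proj₂ to sorted)
    module T = Along.SortedColouring.Optimal x h ham sorted optimal
    module R = Reflection x h ham sorted
    module T′ = Along.SortedColouring.Optimal (reversed x) R.h′ R.ham′ R.sorted′ (trans (cong +_ R.span′) optimal)
    choose : Dec (Lseq d D x 0 ≡ 0) → ∃ λ x → GoodOrdering d D x
    choose (yes first≡0) = x , ends⇒endCond d D x T.ends first≡0 , T.distCond
    -- Then 𝓛(x₀) + 𝓛(x_m) = ζ′ ≤ 1 forces 𝓛(x_m) = 0, and the reflected colouring puts x_m first.
    choose (no  first≢0) = reversed x , ends⇒endCond d D (reversed x) T′.ends first′≡0 , T′.distCond
      where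
      first′≡0 : Lseq d D (reversed x) 0 ≡ 0
      first′≡0 = trans R.first′ (n≤0⇒n≡0 (+-cancelˡ-≤ 1 _ 0 (begin
        1 + Lseq d D x m                ≤⟨ +-monoˡ-≤ (Lseq d D x m) (n≢0⇒n>0 first≢0) ⟩
        Lseq d D x 0 + Lseq d D x m     ≡⟨ T.ends ⟩
        ζ′ d                            ≤⟨ m∸n≤m 1 (ζ d) ⟩
        1                               ∎)))
        where open ≤-Reasoning

  goodOrdering⇒optimal : ∀ x → GoodOrdering d D x →
    (∀ v → + 0 ℤ.≤ hOrd d D x v) × IsHamColoring D (colouring x) × IsHC D (+ span (colouring x))
  goodOrdering⇒optimal x (endCond , distCond) =
    H-nonneg ∘ Along.position x , hamiltonian , (colouring x , hamiltonian , refl) ,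
    λ h ham → subst (ℤ._≤ + span h) (sym span≡formula) (lowerBound h ham)
    where open Along.FromDistCond x distCond (endCond⇒ends d D x centres-count endCond)

  goodOrdering⇒hc : ∀ x → GoodOrdering d D x → IsHC D (hcFormula d D)
  goodOrdering⇒hc x (endCond , distCond) = (colouring x , hamiltonian , span≡formula) , lowerBound
    where open Along.FromDistCond x distCond (endCond⇒ends d D x centres-count endCond)

open import Data.Integer using (∣_∣) renaming (_≤_ to _≤ℤ_)
open import Function.Bundles using (_⇔_; mk⇔)

theorem2 : ∀ (n : ℕ) (Adj : Rel n) → IsTree Adj → 4 ≤ n → MaxDegreeAtLeast3 Adj →
    (d D : Fin n → Fin n → ℕ) → IsDistance Adj d → IsDetour Adj D →
    (IsHC D (hcFormula d D) ⇔ (∃ λ (x : Fin n ↔ Fin n) → GoodOrdering d D x)) ×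
    (∀ (x : Fin n ↔ Fin n) → GoodOrdering d D x →
      (∀ v → + 0 ≤ℤ hOrd d D x v) ×
      IsHamColoring D (λ v → ∣ hOrd d D x v ∣) ×
      IsHC D (+ span (λ v → ∣ hOrd d D x v ∣)))
theorem2 zero    _   _    ()
theorem2 (suc m) Adj tree (s≤s 3≤m) _ d D isDistance isDetour =
  mk⇔ (λ { ((h , ham , optimal) , _) → optimal⇒goodOrdering h ham optimal })
      (λ { (x , good) → goodOrdering⇒hc x good }) ,
  goodOrdering⇒optimal
  where
  open Tree Adj tree
  open Centres d D isDistance isDetour
  open Hamiltonian m d D (≤-trans (s≤s z≤n) 3≤m) D-sym D≤n∸1 D≤𝓛+𝓛+ζ ζ′≤𝓛+𝓛 (centres-count Fin.zero)
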